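{- The graph $F(9,15,21)$ on vertex set $\{1,\dots,9\}$ with edges $\{1,2\},\{2,3\},\{3,5\},\{1,5\},\{1,3\},\{5,6\},\{6,8\},\{7,8\},\{5,7\},\{6,7\},\{3,4\},\{6,9\},\{4,9\},\{4,8\},\{2,9\}$ is forbidden.
   Context: All graphs are finite and simple. A graph $G$ with vertex set $V$ is unit-distance if there exists an injective map $\varphi\colon V\to\mathbf{R}^2$ with $|\varphi(v)-\varphi(w)|=1$ for every pair of adjacent vertices $v,w$ (non-adjacent vertices may also be at distance 1). A graph is forbidden if it is not unit-distance. -}

module Defs where

open import Data.Nat using (ℕ)
open import Data.Fin using (Fin; #_)
open import Data.Product using (Σ; ∃; _×_; _,_)
open import Data.Sum using (_⊎_)
open import Data.Empty using (⊥)
open import Data.List using (List; []; _∷_)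
open import Data.List.Membership.Propositional using (_∈_)
open import Relation.Binary.PropositionalEquality using (_≡_; _≢_)
open import Relation.Binary.Structures using (IsStrictTotalOrder)
open import Algebra.Structures using (IsCommutativeRing)
open import Function.Definitions using (Injective)

-- We therefore axiomatise the
-- real line as a complete ordered field (unique up to isomorphism), with
-- propositional equality as the equality of the carrier.
record RealField : Set₁ where
  infixl 6 _+_
  infixl 7 _*_
  infix 4 _<_ _≤_
  field
    Carrier : Set
    0# 1# : Carrier
    _+_ _*_ : Carrier → Carrier → Carrier
    -_ : Carrier → Carrier
    _<_ : Carrier → Carrier → Set
    isCommutativeRing : IsCommutativeRing _≡_ _+_ _*_ -_ 0# 1#
    0≢1 : 0# ≢ 1#
    inverse : ∀ x → x ≢ 0# → ∃ λ y → x * y ≡ 1#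
    isStrictTotalOrder : IsStrictTotalOrder _≡_ _<_
    +-mono-< : ∀ {x y} z → x < y → x + z < y + z
    *-pos : ∀ {x y} → 0# < x → 0# < y → 0# < x * y

  _≤_ : Carrier → Carrier → Set
  x ≤ y = x < y ⊎ x ≡ y

  _-_ : Carrier → Carrier → Carrier
  x - y = x + (- y)

  field
    complete : (P : Carrier → Set) → (∃ λ x → P x) →
               (∃ λ b → ∀ x → P x → x ≤ b) →
               ∃ λ s → (∀ x → P x → x ≤ s) ×
                       (∀ b → (∀ x → P x → x ≤ b) → s ≤ b)

record Graph (n : ℕ) : Set where
  constructor graph
  field
    edges : List (Fin n × Fin n)

Adj : ∀ {n} → Graph n → Fin n → Fin n → Set
Adj G u w = ((u , w) ∈ Graph.edges G) ⊎ ((w , u) ∈ Graph.edges G)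

module _ (ℝ : RealField) where
  open RealField ℝ

  Point : Set
  Point = Carrier × Carrier

  -- squared Euclidean distance; |p - q| = 1  iff  |p - q|² = 1
  dist² : Point → Point → Carrier
  dist² (x₁ , y₁) (x₂ , y₂) = (x₁ - x₂) * (x₁ - x₂) + (y₁ - y₂) * (y₁ - y₂)

  UnitDistance : ∀ {n} → Graph n → Set
  UnitDistance {n} G =
    Σ (Fin n → Point) λ φ →
      Injective _≡_ _≡_ φ × (∀ u w → Adj G u w → dist² (φ u) (φ w) ≡ 1#)

  Forbidden : ∀ {n} → Graph n → Set
  Forbidden G = UnitDistance G → ⊥

-- F(9,15,21); paper vertex k is  # (k - 1).
F-9-15-21 : Graph 9
F-9-15-21 = graph
  ( (# 0 , # 1) ∷ (# 1 , # 2) ∷ (# 2 , # 4) ∷ (# 0 , # 4) ∷ (# 0 , # 2) ∷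
    (# 4 , # 5) ∷ (# 5 , # 7) ∷ (# 6 , # 7) ∷ (# 4 , # 6) ∷ (# 5 , # 6) ∷
    (# 2 , # 3) ∷ (# 5 , # 8) ∷ (# 3 , # 8) ∷ (# 3 , # 7) ∷ (# 1 , # 8) ∷ [])

module Submission where

-- Write p₁,…,p₉ for the images of the paper's vertices 1,…,9.  The proof
-- rests on one planar fact, the rhombus lemma: two distinct points at a common
-- distance from two distinct points b, c are mirror images in the midpoint of
-- bc, so a + d = b + c.  The graph contains four such rhombi (on the vertex
-- quadruples 2 1 3 5, 8 6 7 5, 3 2 4 9, 6 8 9 4); adding their vector
-- equations gives p₁ = 2p₅ − p₇ and p₈ = p₆ + p₇ − p₅, where 5,6,7 is a unit
-- equilateral triangle.  Vertex 3 is a unit neighbour of p₅ and of p₁.  If p₃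
-- is the reflection 2p₅ − p₆, then p₃ and p₈ are √7 > 2 apart, so they have no
-- common unit neighbour, contradicting the edges 34 and 48.  Otherwise a fifth
-- rhombus gives p₃ = p₅ + p₆ − p₇, so p₃ and p₈ are exactly 2 apart with
-- midpoint p₆, forcing their common unit neighbour p₄ to equal p₆.

open import Defs
open import Data.Nat as ℕ using (ℕ; zero; suc)
import Data.Nat.Properties as ℕP
open import Data.Integer as ℤ using (ℤ; +_; -[1+_]; _⊖_; _◃_; sign; ∣_∣)
import Data.Integer.Properties as ℤP
open import Data.Sign as Sign using (Sign)
open import Data.Fin as Fin using (Fin; #_)
open import Function.Definitions using (Injective)
open import Data.Maybe using (Maybe; just; nothing)
open import Data.Product as Product using (_,_; proj₁; proj₂)
open import Data.Product.Properties using (≡-dec)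
open import Data.Sum using (inj₁; inj₂)
open import Data.Empty using (⊥; ⊥-elim)
open import Relation.Nullary using (yes; no)
open import Relation.Nullary.Decidable using (True; False; toWitness; toWitnessFalse; _⊎-dec_)
open import Relation.Binary.Definitions using (Decidable; DecidableEquality; tri<; tri≈; tri>)
import Relation.Binary.PropositionalEquality as ≡
open ≡ using (_≡_; _≢_)
open import Relation.Binary.Structures using (IsStrictTotalOrder)
open import Algebra.Bundles using (CommutativeRing)
open import Algebra.Solver.Ring.AlmostCommutativeRing
  using (_-Raw-AlmostCommutative⟶_; fromCommutativeRing)

-- Every commutative ring R receives the canonical ring map ℤ → R.  Being a
-- morphism of raw rings it lets us use the standard-library ring solver on R
-- with integer coefficients; R cannot serve as its own coefficient ring, since
-- the solver normalises coefficients by computation.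
module IntegerCoefficients {c ℓ} (R : CommutativeRing c ℓ) where
  open CommutativeRing R
  open import Algebra.Properties.Ring ring
    using (-0#≈0#; -‿involutive; -‿distribˡ-*; -‿distribʳ-*; -‿+-comm)
  open import Algebra.Properties.Semiring.Mult.TCOptimised semiring
    using (_×_; 1+×; ×-homo-+; ×1-homo-*)
  open import Relation.Binary.Reasoning.Setoid setoid

  embed : ℤ → Carrier
  embed (+ n)     = n × 1#
  embed -[1+ n ] = - (suc n × 1#)

  private
    -- Multiplication in ℤ is defined through sign and absolute value, so
    -- the multiplicative law is proved in that representation.
    signed : Sign → Carrier → Carrier
    signed Sign.+ x = x
    signed Sign.- x = - x

    embed-◃ : ∀ s n → embed (s ◃ n) ≈ signed s (n × 1#)
    embed-◃ Sign.- zero    = sym -0#≈0#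
    embed-◃ Sign.+ zero    = refl
    embed-◃ Sign.- (suc n) = refl
    embed-◃ Sign.+ (suc n) = refl

    embed-signAbs : ∀ i → embed i ≈ signed (sign i) (∣ i ∣ × 1#)
    embed-signAbs (+ n)     = refl
    embed-signAbs -[1+ n ] = refl

    signed-cong : ∀ s {x y} → x ≈ y → signed s x ≈ signed s y
    signed-cong Sign.+ x≈y = x≈y
    signed-cong Sign.- x≈y = -‿cong x≈y

    signed-* : ∀ s t x y → signed (s Sign.* t) (x * y) ≈ signed s x * signed t y
    signed-* Sign.+ Sign.+ x y = refl
    signed-* Sign.+ Sign.- x y = -‿distribʳ-* x y
    signed-* Sign.- Sign.+ x y = -‿distribˡ-* x y
    signed-* Sign.- Sign.- x y = begin
      x * y           ≈⟨ -‿involutive (x * y) ⟨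
      - - (x * y)     ≈⟨ -‿cong (-‿distribˡ-* x y) ⟩
      - (- x * y)     ≈⟨ -‿distribʳ-* (- x) y ⟩
      - x * - y       ∎

    x-0≈x : ∀ x → x + - 0# ≈ x
    x-0≈x x = trans (+-congˡ -0#≈0#) (+-identityʳ x)

    cancel-1# : ∀ a b → (1# + a) + - (1# + b) ≈ a + - b
    cancel-1# a b = begin
      (1# + a) + - (1# + b)     ≈⟨ +-congˡ (-‿+-comm 1# b) ⟨
      (1# + a) + (- 1# + - b)   ≈⟨ +-congʳ (+-comm 1# a) ⟩
      (a + 1#) + (- 1# + - b)   ≈⟨ +-assoc a 1# _ ⟩
      a + (1# + (- 1# + - b))   ≈⟨ +-congˡ (+-assoc 1# (- 1#) (- b)) ⟨
      a + ((1# + - 1#) + - b)   ≈⟨ +-congˡ (+-congʳ (-‿inverseʳ 1#)) ⟩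
      a + (0# + - b)            ≈⟨ +-congˡ (+-identityˡ (- b)) ⟩
      a + - b                   ∎

  embed-⊖ : ∀ m n → embed (m ⊖ n) ≈ m × 1# + - (n × 1#)
  embed-⊖ zero    zero    = sym (x-0≈x 0#)
  embed-⊖ (suc m) zero    = sym (x-0≈x (suc m × 1#))
  embed-⊖ zero    (suc n) = sym (+-identityˡ _)
  embed-⊖ (suc m) (suc n) = begin
    embed (suc m ⊖ suc n)               ≡⟨ ≡.cong embed (ℤP.[1+m]⊖[1+n]≡m⊖n m n) ⟩
    embed (m ⊖ n)                       ≈⟨ embed-⊖ m n ⟩
    m × 1# + - (n × 1#)                 ≈⟨ cancel-1# (m × 1#) (n × 1#) ⟨
    (1# + m × 1#) + - (1# + n × 1#)     ≈⟨ +-cong (1+× m 1#) (-‿cong (1+× n 1#)) ⟨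
    suc m × 1# + - (suc n × 1#)         ∎

  embed-+ : ∀ i j → embed (i ℤ.+ j) ≈ embed i + embed j
  embed-+ (+ m)     (+ n)     = ×-homo-+ 1# m n
  embed-+ (+ m)     -[1+ n ] = embed-⊖ m (suc n)
  embed-+ -[1+ m ] (+ n)     = trans (embed-⊖ n (suc m)) (+-comm _ _)
  embed-+ -[1+ m ] -[1+ n ] = begin
    - (suc (suc m ℕ.+ n) × 1#)          ≡⟨ ≡.cong (λ k → - (k × 1#)) (ℕP.+-suc (suc m) n) ⟨
    - ((suc m ℕ.+ suc n) × 1#)          ≈⟨ -‿cong (×-homo-+ 1# (suc m) (suc n)) ⟩
    - (suc m × 1# + suc n × 1#)         ≈⟨ -‿+-comm _ _ ⟨
    - (suc m × 1#) + - (suc n × 1#)     ∎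

  embed-* : ∀ i j → embed (i ℤ.* j) ≈ embed i * embed j
  embed-* i j = begin
    embed (i ℤ.* j)                               ≈⟨ embed-◃ (s Sign.* t) (m ℕ.* n) ⟩
    signed (s Sign.* t) ((m ℕ.* n) × 1#)          ≈⟨ signed-cong (s Sign.* t) (×1-homo-* m n) ⟩
    signed (s Sign.* t) (m × 1# * n × 1#)         ≈⟨ signed-* s t _ _ ⟩
    signed s (m × 1#) * signed t (n × 1#)         ≈⟨ *-cong (embed-signAbs i) (embed-signAbs j) ⟨
    embed i * embed j                             ∎
    where
    s t : Sign
    s = sign i
    t = sign j
    m n : ℕ
    m = ∣ i ∣
    n = ∣ j ∣

  embed-neg : ∀ i → embed (ℤ.- i) ≈ - embed i
  embed-neg (+ zero)  = sym -0#≈0#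
  embed-neg (+ suc n) = refl
  embed-neg -[1+ n ] = sym (-‿involutive _)

  embed-morphism : ℤ.+-*-rawRing -Raw-AlmostCommutative⟶ fromCommutativeRing R
  embed-morphism = record
    { ⟦_⟧    = embed
    ; +-homo = embed-+
    ; *-homo = embed-*
    ; -‿homo = embed-neg
    ; 0-homo = refl
    ; 1-homo = refl
    }

  embed-equal? : ∀ i j → Maybe (embed i ≈ embed j)
  embed-equal? i j with i ℤ.≟ j
  ... | yes i≡j = just (reflexive (≡.cong embed i≡j))
  ... | no _    = nothing

  open import Algebra.Solver.Ring ℤ.+-*-rawRing (fromCommutativeRing R) embed-morphism embed-equal? public

open ≡ using (refl; sym; trans; cong; cong₂; subst; subst₂; module ≡-Reasoning)

-- Plane geometry over a real field.  Squared distances are used throughout,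
-- so everything is polynomial and no square roots are needed.
module EuclideanPlane (ℝ : RealField) where
  open RealField ℝ
  open IsStrictTotalOrder isStrictTotalOrder
    using (compare; _≟_) renaming (irrefl to <-irrefl; trans to <-trans)

  ℝ-ring : CommutativeRing _ _
  ℝ-ring = record { isCommutativeRing = isCommutativeRing }

  open CommutativeRing ℝ-ring using
    ( +-identityˡ; +-identityʳ; +-comm; -‿inverseʳ
    ; *-identityˡ; *-identityʳ; *-assoc; *-comm; zeroˡ; zeroʳ)
  open import Algebra.Properties.Ring (CommutativeRing.ring ℝ-ring)
    using (x∙y⁻¹≈ε⇒x≈y; +-identityˡ-unique)
  import Algebra.Properties.Semiring.Mult.TCOptimised (CommutativeRing.semiring ℝ-ring) as Mult
  open IntegerCoefficients ℝ-ring
    using (solve; Polynomial; con; _:+_; _:-_; _:*_; :-_; _:=_)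

  -- The numeral n of the field; it coincides with what the solver's integer
  -- constant n evaluates to, so numerals can appear in solver goals.
  ⌜_⌝ : ℕ → Carrier
  ⌜ n ⌝ = n Mult.× 1#

  sub-zero : ∀ {x y} → x - y ≡ 0# → x ≡ y
  sub-zero = x∙y⁻¹≈ε⇒x≈y _ _

  pos⇒≢0 : ∀ {x} → 0# < x → x ≢ 0#
  pos⇒≢0 0<x refl = <-irrefl refl 0<x

  neg⇒-pos : ∀ {x} → x < 0# → 0# < - x
  neg⇒-pos {x} x<0 = subst₂ _<_ (-‿inverseʳ x) (+-identityˡ (- x)) (+-mono-< (- x) x<0)

  square-pos : ∀ {x} → x ≢ 0# → 0# < x * x
  square-pos {x} x≢0 with compare x 0#
  ... | tri< x<0 _ _ = subst (0# <_) neg-square (*-pos (neg⇒-pos x<0) (neg⇒-pos x<0))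
    where
    neg-square : (- x) * (- x) ≡ x * x
    neg-square = solve 1 (λ x → (:- x) :* (:- x) := x :* x) refl x
  ... | tri≈ _ x≡0 _ = ⊥-elim (x≢0 x≡0)
  ... | tri> _ _ 0<x = *-pos 0<x 0<x

  square-nonneg : ∀ x → 0# ≤ x * x
  square-nonneg x with x ≟ 0#
  ... | yes refl = inj₂ (sym (zeroˡ 0#))
  ... | no x≢0   = inj₁ (square-pos x≢0)

  pos+nonneg : ∀ {a b} → 0# < a → 0# ≤ b → 0# < a + b
  pos+nonneg {a} 0<a (inj₂ refl) = subst (0# <_) (sym (+-identityʳ a)) 0<a
  pos+nonneg {a} {b} 0<a (inj₁ 0<b) =
    <-trans 0<b (subst (_< a + b) (+-identityˡ b) (+-mono-< b 0<a))

  nonneg+nonneg : ∀ {a b} → 0# ≤ a → 0# ≤ b → 0# ≤ a + b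
  nonneg+nonneg (inj₁ 0<a) 0≤b = inj₁ (pos+nonneg 0<a 0≤b)
  nonneg+nonneg {b = b} (inj₂ refl) 0≤b = subst (0# ≤_) (sym (+-identityˡ b)) 0≤b

  numeral-pos : ∀ n → 0# < ⌜ suc n ⌝
  numeral-pos zero    = subst (0# <_) (*-identityˡ 1#) (square-pos (λ 1≡0 → 0≢1 (sym 1≡0)))
  numeral-pos (suc n) = pos+nonneg (numeral-pos n) (inj₁ (numeral-pos zero))

  sum-of-squares-zero : ∀ {x y} → x * x + y * y ≡ 0# → x ≡ 0#
  sum-of-squares-zero {x} {y} e with x ≟ 0#
  ... | yes x≡0 = x≡0
  ... | no x≢0  = ⊥-elim (pos⇒≢0 (pos+nonneg (square-pos x≢0) (square-nonneg y)) e)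

  product-zero : ∀ {x y} → x * y ≡ 0# → x ≢ 0# → y ≡ 0#
  product-zero {x} {y} xy≡0 x≢0 with inverse x x≢0
  ... | z , xz≡1 = begin
    y             ≡⟨ sym (*-identityˡ y) ⟩
    1# * y        ≡⟨ cong (_* y) (sym xz≡1) ⟩
    (x * z) * y   ≡⟨ cong (_* y) (*-comm x z) ⟩
    (z * x) * y   ≡⟨ *-assoc z x y ⟩
    z * (x * y)   ≡⟨ cong (z *_) xy≡0 ⟩
    z * 0#        ≡⟨ zeroʳ z ⟩
    0#            ∎
    where open ≡-Reasoning

  halve : ∀ {x y} → x + x ≡ y + y → x ≡ y
  halve {x} {y} e = sub-zero (product-zero two-times-difference (pos⇒≢0 (numeral-pos 1)))
    where
    open ≡-Reasoning
    two-times-difference : ⌜ 2 ⌝ * (x - y) ≡ 0#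
    two-times-difference = begin
      ⌜ 2 ⌝ * (x - y)
        ≡⟨ solve 2 (λ x y → con (+ 2) :* (x :- y) := (x :+ x) :- (y :+ y)) refl x y ⟩
      (x + x) - (y + y)   ≡⟨ cong (_- (y + y)) e ⟩
      (y + y) - (y + y)   ≡⟨ -‿inverseʳ (y + y) ⟩
      0#                  ∎

  -- Points of the plane double as vectors; _·_ is the dot product, and the
  -- squared distance of Defs is definitionally (p -ᵥ q) · (p -ᵥ q).
  P : Set
  P = Point ℝ

  d² : P → P → Carrier
  d² = dist² ℝ

  infixl 6 _+ᵥ_ _-ᵥ_
  infix  7 _·_

  _+ᵥ_ _-ᵥ_ : P → P → P
  p +ᵥ q = (proj₁ p + proj₁ q , proj₂ p + proj₂ q)
  p -ᵥ q = (proj₁ p - proj₁ q , proj₂ p - proj₂ q)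

  _·_ : P → P → Carrier
  u · v = proj₁ u * proj₁ v + proj₂ u * proj₂ v

  𝟎 : P
  𝟎 = (0# , 0#)

  reflect : P → P → P
  reflect o p = (o +ᵥ o) -ᵥ p

  _≟ᵥ_ : DecidableEquality P
  _≟ᵥ_ = ≡-dec _≟_ _≟_

  -- The same vector operations on solver expressions, so that identities
  -- between points can be handed to the ring solver coordinate by coordinate.
  Polynomial² : ℕ → Set
  Polynomial² n = Polynomial n Product.× Polynomial n

  module VectorSyntax {n : ℕ} where
    infixl 7 _:+ᵥ_ _:-ᵥ_
    infix  8 _:·_

    _:+ᵥ_ _:-ᵥ_ : Polynomial² n → Polynomial² n → Polynomial² n
    p :+ᵥ q = (proj₁ p :+ proj₁ q , proj₂ p :+ proj₂ q)
    p :-ᵥ q = (proj₁ p :- proj₁ q , proj₂ p :- proj₂ q)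

    _:·_ : Polynomial² n → Polynomial² n → Polynomial n
    u :· v = proj₁ u :* proj₁ v :+ proj₂ u :* proj₂ v

    :d² : Polynomial² n → Polynomial² n → Polynomial n
    :d² p q = (p :-ᵥ q) :· (p :-ᵥ q)

    :reflect : Polynomial² n → Polynomial² n → Polynomial² n
    :reflect o p = (o :+ᵥ o) :-ᵥ p

  open VectorSyntax

  parallelogram-law : ∀ x a b →
    d² (x +ᵥ x) (a +ᵥ b) + d² a b ≡ ⌜ 2 ⌝ * d² x a + ⌜ 2 ⌝ * d² x b
  parallelogram-law (x₁ , x₂) (a₁ , a₂) (b₁ , b₂) = solve 6
    (λ x₁ x₂ a₁ a₂ b₁ b₂ → let x = (x₁ , x₂); a = (a₁ , a₂); b = (b₁ , b₂) in
      :d² (x :+ᵥ x) (a :+ᵥ b) :+ :d² a b := con (+ 2) :* :d² x a :+ con (+ 2) :* :d² x b)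
    refl x₁ x₂ a₁ a₂ b₁ b₂

  point-≡ : ∀ {p q : P} → proj₁ p ≡ proj₁ q → proj₂ p ≡ proj₂ q → p ≡ q
  point-≡ = cong₂ _,_

  sub-zeroᵥ : ∀ {p q} → p -ᵥ q ≡ 𝟎 → p ≡ q
  sub-zeroᵥ e = point-≡ (sub-zero (cong proj₁ e)) (sub-zero (cong proj₂ e))

  halveᵥ : ∀ {p q} → p +ᵥ p ≡ q +ᵥ q → p ≡ q
  halveᵥ e = point-≡ (halve (cong proj₁ e)) (halve (cong proj₂ e))

  norm-zero : ∀ u → u · u ≡ 0# → u ≡ 𝟎
  norm-zero (u₁ , u₂) e = point-≡ (sum-of-squares-zero e) (sum-of-squares-zero (trans (+-comm _ _) e))

  d²-nonneg : ∀ p q → 0# ≤ d² p q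
  d²-nonneg p q = nonneg+nonneg (square-nonneg _) (square-nonneg _)

  d²-zero : ∀ {p q} → d² p q ≡ 0# → p ≡ q
  d²-zero {p} {q} e = sub-zeroᵥ (norm-zero (p -ᵥ q) e)

  -- In the plane, a vector orthogonal to two nonzero orthogonal vectors u, v
  -- is zero: by Lagrange's identity the cross product of u and v is nonzero,
  -- and Cramer's rule then solves w · u = w · v = 0 uniquely.
  orthogonal-to-basis : ∀ u v w →
    u · v ≡ 0# → u ≢ 𝟎 → v ≢ 𝟎 → w · u ≡ 0# → w · v ≡ 0# → w ≡ 𝟎
  orthogonal-to-basis u@(u₁ , u₂) v@(v₁ , v₂) w@(w₁ , w₂) u·v≡0 u≢𝟎 v≢𝟎 w·u≡0 w·v≡0 =
    point-≡ (product-zero (trans cramer₁ (vanishing v₂ u₂ w·u≡0 w·v≡0)) cross≢0)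
            (product-zero (trans cramer₂ (vanishing u₁ v₁ w·v≡0 w·u≡0)) cross≢0)
    where
    open ≡-Reasoning
    cross : Carrier
    cross = (u₁ * v₂) - (u₂ * v₁)

    lagrange : cross * cross + (u · v) * (u · v) ≡ (u · u) * (v · v)
    lagrange = solve 4 (λ u₁ u₂ v₁ v₂ → let u = (u₁ , u₂); v = (v₁ , v₂) in
      (u₁ :* v₂ :- u₂ :* v₁) :* (u₁ :* v₂ :- u₂ :* v₁) :+ (u :· v) :* (u :· v)
        := (u :· u) :* (v :· v))
      refl u₁ u₂ v₁ v₂

    cross≢0 : cross ≢ 0#
    cross≢0 cross≡0 with u · u ≟ 0#
    ... | yes u·u≡0 = u≢𝟎 (norm-zero u u·u≡0)
    ... | no u·u≢0  = v≢𝟎 (norm-zero v (product-zero norms≡0 u·u≢0))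
      where
      norms≡0 : (u · u) * (v · v) ≡ 0#
      norms≡0 = begin
        (u · u) * (v · v)                    ≡⟨ sym lagrange ⟩
        cross * cross + (u · v) * (u · v)    ≡⟨ cong₂ (λ s t → s * s + t * t) cross≡0 u·v≡0 ⟩
        0# * 0# + 0# * 0#                    ≡⟨ solve 0 (con (+ 0) :* con (+ 0) :+ con (+ 0) :* con (+ 0)
                                                           := con (+ 0)) refl ⟩
        0#                                   ∎

    cramer₁ : cross * w₁ ≡ (v₂ * (w · u)) - (u₂ * (w · v))
    cramer₁ = solve 6 (λ u₁ u₂ v₁ v₂ w₁ w₂ → let u = (u₁ , u₂); v = (v₁ , v₂); w = (w₁ , w₂) in
      (u₁ :* v₂ :- u₂ :* v₁) :* w₁ := v₂ :* (w :· u) :- u₂ :* (w :· v))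
      refl u₁ u₂ v₁ v₂ w₁ w₂

    cramer₂ : cross * w₂ ≡ (u₁ * (w · v)) - (v₁ * (w · u))
    cramer₂ = solve 6 (λ u₁ u₂ v₁ v₂ w₁ w₂ → let u = (u₁ , u₂); v = (v₁ , v₂); w = (w₁ , w₂) in
      (u₁ :* v₂ :- u₂ :* v₁) :* w₂ := u₁ :* (w :· v) :- v₁ :* (w :· u))
      refl u₁ u₂ v₁ v₂ w₁ w₂

    vanishing : ∀ a b {s t} → s ≡ 0# → t ≡ 0# → (a * s) - (b * t) ≡ 0#
    vanishing a b refl refl = solve 2 (λ a b → a :* con (+ 0) :- b :* con (+ 0) := con (+ 0)) refl a b

  -- If 2X is a signed combination of four equal quantities with total sign
  -- zero, then X = 0.  This turns the polarisation identities below into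
  -- orthogonality statements.
  balanced : ∀ {X A B C D s} → (X + X) + (A + B) ≡ C + D → A ≡ s → B ≡ s → C ≡ s → D ≡ s → X ≡ 0#
  balanced e refl refl refl refl = halve (trans (+-identityˡ-unique _ _ e) (sym (+-identityˡ 0#)))

  -- With u = a − d, v = c − b and w = (a + d) − (b + c), polarisation gives
  -- u ⊥ v, w ⊥ u and w ⊥ v, so w = 0.
  rhombus : ∀ {s} a b c d → d² a b ≡ s → d² a c ≡ s → d² d b ≡ s → d² d c ≡ s → b ≢ c → a ≢ d →
            a +ᵥ d ≡ b +ᵥ c
  rhombus a@(a₁ , a₂) b@(b₁ , b₂) c@(c₁ , c₂) d@(d₁ , d₂) ab ac db dc b≢c a≢d =
    sub-zeroᵥ (orthogonal-to-basis u v w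
      (balanced uv-identity ac db ab dc) u≢𝟎 v≢𝟎
      (balanced wu-identity db dc ab ac) (balanced wv-identity ac dc ab db))
    where
    u v w : P
    u = a -ᵥ d
    v = c -ᵥ b
    w = (a +ᵥ d) -ᵥ (b +ᵥ c)

    u≢𝟎 : u ≢ 𝟎
    u≢𝟎 u≡𝟎 = a≢d (sub-zeroᵥ u≡𝟎)

    v≢𝟎 : v ≢ 𝟎
    v≢𝟎 v≡𝟎 = b≢c (sym (sub-zeroᵥ v≡𝟎))

    uv-identity : (u · v + u · v) + (d² a c + d² d b) ≡ d² a b + d² d c
    uv-identity = solve 8 (λ a₁ a₂ b₁ b₂ c₁ c₂ d₁ d₂ →
      let a = (a₁ , a₂); b = (b₁ , b₂); c = (c₁ , c₂); d = (d₁ , d₂); u = a :-ᵥ d; v = c :-ᵥ b in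
      (u :· v :+ u :· v) :+ (:d² a c :+ :d² d b) := :d² a b :+ :d² d c)
      refl a₁ a₂ b₁ b₂ c₁ c₂ d₁ d₂

    wu-identity : (w · u + w · u) + (d² d b + d² d c) ≡ d² a b + d² a c
    wu-identity = solve 8 (λ a₁ a₂ b₁ b₂ c₁ c₂ d₁ d₂ →
      let a = (a₁ , a₂); b = (b₁ , b₂); c = (c₁ , c₂); d = (d₁ , d₂)
          u = a :-ᵥ d; w = (a :+ᵥ d) :-ᵥ (b :+ᵥ c) in
      (w :· u :+ w :· u) :+ (:d² d b :+ :d² d c) := :d² a b :+ :d² a c)
      refl a₁ a₂ b₁ b₂ c₁ c₂ d₁ d₂

    wv-identity : (w · v + w · v) + (d² a c + d² d c) ≡ d² a b + d² d b
    wv-identity = solve 8 (λ a₁ a₂ b₁ b₂ c₁ c₂ d₁ d₂ →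
      let a = (a₁ , a₂); b = (b₁ , b₂); c = (c₁ , c₂); d = (d₁ , d₂)
          v = c :-ᵥ b; w = (a :+ᵥ d) :-ᵥ (b :+ᵥ c) in
      (w :· v :+ w :· v) :+ (:d² a c :+ :d² d c) := :d² a b :+ :d² d b)
      refl a₁ a₂ b₁ b₂ c₁ c₂ d₁ d₂

  solve-for : ∀ {a b c} → a + b ≡ c → a ≡ c - b
  solve-for {a} {b} refl = solve 2 (λ a b → a := (a :+ b) :- b) refl a b

  solve-forᵥ : ∀ {p q s} → p +ᵥ q ≡ s → p ≡ s -ᵥ q
  solve-forᵥ e = point-≡ (solve-for (cong proj₁ e)) (solve-for (cong proj₂ e))

  -- Adding the equations of four parallelograms that close up around a cycle
  -- expresses x₁ through x₅ and x₇.
  closing-parallelograms : ∀ {x₁ x₂ x₃ x₄ x₅ x₆ x₇ x₈ x₉} →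
    x₂ + x₅ ≡ x₁ + x₃ → x₈ + x₅ ≡ x₆ + x₇ → x₃ + x₉ ≡ x₂ + x₄ → x₆ + x₄ ≡ x₈ + x₉ →
    x₁ ≡ (x₅ + x₅) - x₇
  closing-parallelograms {x₁} {x₂} {x₃} {x₄} {x₅} {x₆} {x₇} {x₈} {x₉} e₁ e₂ e₃ e₄ = sub-zero (begin
    x₁ - ((x₅ + x₅) - x₇)        ≡⟨ telescoping ⟩
    ((δ₁ + δ₂) + δ₃) + δ₄        ≡⟨ cong₂ _+_ (cong₂ _+_ (cong₂ _+_ (defect-zero e₁) (defect-zero e₂))
                                                         (defect-zero e₃))
                                              (defect-zero e₄) ⟩
    ((0# + 0#) + 0#) + 0#        ≡⟨ solve 0 (((con (+ 0) :+ con (+ 0)) :+ con (+ 0)) :+ con (+ 0)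
                                               := con (+ 0)) refl ⟩
    0#                           ∎)
    where
    open ≡-Reasoning
    δ₁ δ₂ δ₃ δ₄ : Carrier
    δ₁ = (x₁ + x₃) - (x₂ + x₅)
    δ₂ = (x₆ + x₇) - (x₈ + x₅)
    δ₃ = (x₂ + x₄) - (x₃ + x₉)
    δ₄ = (x₈ + x₉) - (x₆ + x₄)

    defect-zero : ∀ {a b} → a ≡ b → b - a ≡ 0#
    defect-zero {a} refl = -‿inverseʳ a

    telescoping : x₁ - ((x₅ + x₅) - x₇) ≡ ((δ₁ + δ₂) + δ₃) + δ₄
    telescoping = solve 9 (λ x₁ x₂ x₃ x₄ x₅ x₆ x₇ x₈ x₉ →
      x₁ :- ((x₅ :+ x₅) :- x₇)
        := ((((x₁ :+ x₃) :- (x₂ :+ x₅)) :+ ((x₆ :+ x₇) :- (x₈ :+ x₅)))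
             :+ ((x₂ :+ x₄) :- (x₃ :+ x₉))) :+ ((x₈ :+ x₉) :- (x₆ :+ x₄)))
      refl x₁ x₂ x₃ x₄ x₅ x₆ x₇ x₈ x₉

  closing-parallelogramsᵥ : ∀ {p₁ p₂ p₃ p₄ p₅ p₆ p₇ p₈ p₉} →
    p₂ +ᵥ p₅ ≡ p₁ +ᵥ p₃ → p₈ +ᵥ p₅ ≡ p₆ +ᵥ p₇ → p₃ +ᵥ p₉ ≡ p₂ +ᵥ p₄ → p₆ +ᵥ p₄ ≡ p₈ +ᵥ p₉ →
    p₁ ≡ reflect p₅ p₇
  closing-parallelogramsᵥ e₁ e₂ e₃ e₄ =
    point-≡ (closing-parallelograms (cong proj₁ e₁) (cong proj₁ e₂) (cong proj₁ e₃) (cong proj₁ e₄))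
            (closing-parallelograms (cong proj₂ e₁) (cong proj₂ e₂) (cong proj₂ e₃) (cong proj₂ e₄))

  reflect-isometry : ∀ o p q → d² (reflect o p) (reflect o q) ≡ d² p q
  reflect-isometry (o₁ , o₂) (p₁ , p₂) (q₁ , q₂) = solve 6 (λ o₁ o₂ p₁ p₂ q₁ q₂ →
    let o = (o₁ , o₂); p = (p₁ , p₂); q = (q₁ , q₂) in
    :d² (:reflect o p) (:reflect o q) := :d² p q)
    refl o₁ o₂ p₁ p₂ q₁ q₂

  reflect-centre : ∀ o p → d² (reflect o p) o ≡ d² p o
  reflect-centre (o₁ , o₂) (p₁ , p₂) = solve 4 (λ o₁ o₂ p₁ p₂ →
    let o = (o₁ , o₂); p = (p₁ , p₂) in
    :d² (:reflect o p) o := :d² p o)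
    refl o₁ o₂ p₁ p₂

  common-unit-neighbour : ∀ {x a b} → d² x a ≡ 1# → d² x b ≡ 1# →
                          d² (x +ᵥ x) (a +ᵥ b) + d² a b ≡ ⌜ 4 ⌝
  common-unit-neighbour {x} {a} {b} xa xb = begin
    d² (x +ᵥ x) (a +ᵥ b) + d² a b      ≡⟨ parallelogram-law x a b ⟩
    ⌜ 2 ⌝ * d² x a + ⌜ 2 ⌝ * d² x b    ≡⟨ cong₂ (λ s t → ⌜ 2 ⌝ * s + ⌜ 2 ⌝ * t) xa xb ⟩
    ⌜ 2 ⌝ * 1# + ⌜ 2 ⌝ * 1#            ≡⟨ solve 0 (con (+ 2) :* con (+ 1) :+ con (+ 2) :* con (+ 1)
                                                     := con (+ 4)) refl ⟩
    ⌜ 4 ⌝                              ∎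
    where open ≡-Reasoning

  midpoint-of-diameter : ∀ {x a b} → d² a b ≡ ⌜ 4 ⌝ → d² x a ≡ 1# → d² x b ≡ 1# → x +ᵥ x ≡ a +ᵥ b
  midpoint-of-diameter {x} {a} {b} ab xa xb = d²-zero (+-identityˡ-unique _ _ (begin
    d² (x +ᵥ x) (a +ᵥ b) + ⌜ 4 ⌝       ≡⟨ cong (λ d → d² (x +ᵥ x) (a +ᵥ b) + d) (sym ab) ⟩
    d² (x +ᵥ x) (a +ᵥ b) + d² a b      ≡⟨ common-unit-neighbour xa xb ⟩
    ⌜ 4 ⌝                              ∎))
    where open ≡-Reasoning

  too-far-apart : ∀ {t x a b} → 0# < t → d² a b ≡ ⌜ 4 ⌝ + t → d² x a ≡ 1# → d² x b ≡ 1# → ⊥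
  too-far-apart {t} {x} {a} {b} 0<t ab xa xb =
    pos⇒≢0 (pos+nonneg 0<t (d²-nonneg (x +ᵥ x) (a +ᵥ b))) (+-identityˡ-unique _ _ (begin
      (t + S) + ⌜ 4 ⌝      ≡⟨ solve 2 (λ t S → (t :+ S) :+ con (+ 4) := S :+ (con (+ 4) :+ t)) refl t S ⟩
      S + (⌜ 4 ⌝ + t)      ≡⟨ cong (λ d → S + d) (sym ab) ⟩
      S + d² a b           ≡⟨ common-unit-neighbour xa xb ⟩
      ⌜ 4 ⌝                ∎))
    where
    open ≡-Reasoning
    S : Carrier
    S = d² (x +ᵥ x) (a +ᵥ b)

  -- For a unit equilateral triangle o p r, the points 2o − p and p + r − o are
  -- at distance √7, since |(2o − p) − (p + r − o)|² = 6|p − o|² + 3|r − o|² − 2|p − r|².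
  far-corners : ∀ {o p r} → d² p o ≡ 1# → d² r o ≡ 1# → d² p r ≡ 1# →
                d² (reflect o p) ((p +ᵥ r) -ᵥ o) ≡ ⌜ 4 ⌝ + ⌜ 3 ⌝
  far-corners {o@(o₁ , o₂)} {p@(p₁ , p₂)} {r@(r₁ , r₂)} po ro pr = begin
    D                                           ≡⟨ solve-for D+2≡9 ⟩
    (⌜ 6 ⌝ * 1# + ⌜ 3 ⌝ * 1#) - (⌜ 2 ⌝ * 1#)    ≡⟨ solve 0 ((con (+ 6) :* con (+ 1) :+ con (+ 3) :* con (+ 1))
                                                            :- con (+ 2) :* con (+ 1)
                                                            := con (+ 4) :+ con (+ 3)) refl ⟩
    ⌜ 4 ⌝ + ⌜ 3 ⌝                               ∎
    where
    open ≡-Reasoning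
    D : Carrier
    D = d² (reflect o p) ((p +ᵥ r) -ᵥ o)

    identity : D + ⌜ 2 ⌝ * d² p r ≡ ⌜ 6 ⌝ * d² p o + ⌜ 3 ⌝ * d² r o
    identity = solve 6 (λ o₁ o₂ p₁ p₂ r₁ r₂ → let o = (o₁ , o₂); p = (p₁ , p₂); r = (r₁ , r₂) in
      :d² (:reflect o p) ((p :+ᵥ r) :-ᵥ o) :+ con (+ 2) :* :d² p r
        := con (+ 6) :* :d² p o :+ con (+ 3) :* :d² r o)
      refl o₁ o₂ p₁ p₂ r₁ r₂

    D+2≡9 : D + ⌜ 2 ⌝ * 1# ≡ ⌜ 6 ⌝ * 1# + ⌜ 3 ⌝ * 1#
    D+2≡9 = begin
      D + ⌜ 2 ⌝ * 1#                     ≡⟨ cong (λ s → D + ⌜ 2 ⌝ * s) (sym pr) ⟩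
      D + ⌜ 2 ⌝ * d² p r                 ≡⟨ identity ⟩
      ⌜ 6 ⌝ * d² p o + ⌜ 3 ⌝ * d² r o    ≡⟨ cong₂ (λ s t → ⌜ 6 ⌝ * s + ⌜ 3 ⌝ * t) po ro ⟩
      ⌜ 6 ⌝ * 1# + ⌜ 3 ⌝ * 1#            ∎

  -- The points o + p − r, written (o + (2o − r)) − (2o − p) as it arises from
  -- the rhombus lemma, and p + r − o are 2|r − o| apart and have midpoint p.
  shifted-pair-d² : ∀ o p r →
    d² ((o +ᵥ reflect o r) -ᵥ reflect o p) ((p +ᵥ r) -ᵥ o) ≡ ⌜ 4 ⌝ * d² r o
  shifted-pair-d² (o₁ , o₂) (p₁ , p₂) (r₁ , r₂) = solve 6 (λ o₁ o₂ p₁ p₂ r₁ r₂ →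
    let o = (o₁ , o₂); p = (p₁ , p₂); r = (r₁ , r₂) in
    :d² ((o :+ᵥ :reflect o r) :-ᵥ :reflect o p) ((p :+ᵥ r) :-ᵥ o) := con (+ 4) :* :d² r o)
    refl o₁ o₂ p₁ p₂ r₁ r₂

  shifted-pair-sum : ∀ o p r → ((o +ᵥ reflect o r) -ᵥ reflect o p) +ᵥ ((p +ᵥ r) -ᵥ o) ≡ p +ᵥ p
  shifted-pair-sum (o₁ , o₂) (p₁ , p₂) (r₁ , r₂) = point-≡ (coordinate o₁ p₁ r₁) (coordinate o₂ p₂ r₂)
    where
    coordinate : ∀ o p r → ((o + ((o + o) - r)) - ((o + o) - p)) + ((p + r) - o) ≡ p + p
    coordinate = solve 3 (λ o p r →
      ((o :+ ((o :+ o) :- r)) :- ((o :+ o) :- p)) :+ ((p :+ r) :- o) := p :+ p) refl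

  -- The heart of the argument (paper labels o, p, r, t, x = 5, 6, 7, 3, 4; the
  -- points 2o − r and p + r − o are the positions of vertices 1 and 8).  If t is
  -- the reflection 2o − p, then t and p + r − o are √7 apart and x cannot be a
  -- unit neighbour of both.  Otherwise t and 2o − p are the two unit neighbours
  -- of o and 2o − r, so the rhombus lemma gives t = o + p − r, which is at
  -- distance 2 from p + r − o with midpoint p; hence x = p.
  equilateral-configuration : ∀ {o p r t x} →
    d² p o ≡ 1# → d² r o ≡ 1# → d² p r ≡ 1# →
    d² t o ≡ 1# → d² t (reflect o r) ≡ 1# →
    d² x t ≡ 1# → d² x ((p +ᵥ r) -ᵥ o) ≡ 1# →
    o ≢ reflect o r → x ≢ p → ⊥
  equilateral-configuration {o} {p} {r} {t} {x} po ro pr to tc xt xb o≢c x≢p with t ≟ᵥ reflect o p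
  ... | yes refl = too-far-apart (numeral-pos 2) (far-corners po ro pr) xt xb
  ... | no t≢q   = x≢p (halveᵥ (begin
    x +ᵥ x                      ≡⟨ midpoint-of-diameter diameter (subst (λ s → d² x s ≡ 1#) t≡t′ xt) xb ⟩
    t′ +ᵥ ((p +ᵥ r) -ᵥ o)       ≡⟨ shifted-pair-sum o p r ⟩
    p +ᵥ p                      ∎))
    where
    open ≡-Reasoning
    t′ : P
    t′ = (o +ᵥ reflect o r) -ᵥ reflect o p

    t≡t′ : t ≡ t′
    t≡t′ = solve-forᵥ (rhombus t o (reflect o r) (reflect o p) to tc
                         (trans (reflect-centre o p) po) (trans (reflect-isometry o p r) pr) o≢c t≢q)

    diameter : d² t′ ((p +ᵥ r) -ᵥ o) ≡ ⌜ 4 ⌝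
    diameter = trans (shifted-pair-d² o p r) (trans (cong (⌜ 4 ⌝ *_) ro) (*-identityʳ ⌜ 4 ⌝))

-- Adjacency in a graph given by an edge list is decidable, so individual edges
-- of F(9,15,21) can be certified by computation.
adjacent? : ∀ {n} (G : Graph n) → Decidable (Adj G)
adjacent? G u w = ((u , w) ∈? Graph.edges G) ⊎-dec ((w , u) ∈? Graph.edges G)
  where open import Data.List.Membership.DecPropositional (≡-dec Fin._≟_ Fin._≟_) using (_∈?_)

module UnitDistanceEmbedding (ℝ : RealField) {n} (G : Graph n) (φ : Fin n → Point ℝ)
  (φ-injective : Injective _≡_ _≡_ φ)
  (unit : ∀ u w → Adj G u w → dist² ℝ (φ u) (φ w) ≡ RealField.1# ℝ) where

  edge : ∀ u w → {True (adjacent? G u w)} → dist² ℝ (φ u) (φ w) ≡ RealField.1# ℝ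
  edge u w {u~w} = unit u w (toWitness u~w)

  distinct : ∀ u w → {False (u Fin.≟ w)} → φ u ≢ φ w
  distinct u w {u≢w} φu≡φw = toWitnessFalse u≢w (φ-injective φu≡φw)

mainTheorem16 : (ℝ : RealField) → Forbidden ℝ F-9-15-21
mainTheorem16 ℝ (φ , φ-injective , unit) =
  equilateral-configuration (edge (# 5) (# 4)) (edge (# 6) (# 4)) (edge (# 5) (# 6))
    (edge (# 2) (# 4)) (subst (λ c → d² p₃ c ≡ 1#) p₁-is-reflection (edge (# 2) (# 0)))
    (edge (# 3) (# 2)) (subst (λ b → d² p₄ b ≡ 1#) p₈-position (edge (# 3) (# 7)))
    (λ p₅≡c → distinct (# 4) (# 0) (trans p₅≡c (sym p₁-is-reflection))) (distinct (# 3) (# 5))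
  where
  open RealField ℝ using (1#)
  open EuclideanPlane ℝ
  open UnitDistanceEmbedding ℝ F-9-15-21 φ φ-injective unit

  p₁ p₂ p₃ p₄ p₅ p₆ p₇ p₈ p₉ : P
  p₁ = φ (# 0); p₂ = φ (# 1); p₃ = φ (# 2); p₄ = φ (# 3); p₅ = φ (# 4)
  p₆ = φ (# 5); p₇ = φ (# 6); p₈ = φ (# 7); p₉ = φ (# 8)

  rhombus₁ : p₂ +ᵥ p₅ ≡ p₁ +ᵥ p₃
  rhombus₁ = rhombus p₂ p₁ p₃ p₅ (edge (# 1) (# 0)) (edge (# 1) (# 2)) (edge (# 4) (# 0)) (edge (# 4) (# 2))
                     (distinct (# 0) (# 2)) (distinct (# 1) (# 4))

  rhombus₂ : p₈ +ᵥ p₅ ≡ p₆ +ᵥ p₇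
  rhombus₂ = rhombus p₈ p₆ p₇ p₅ (edge (# 7) (# 5)) (edge (# 7) (# 6)) (edge (# 4) (# 5)) (edge (# 4) (# 6))
                     (distinct (# 5) (# 6)) (distinct (# 7) (# 4))

  rhombus₃ : p₃ +ᵥ p₉ ≡ p₂ +ᵥ p₄
  rhombus₃ = rhombus p₃ p₂ p₄ p₉ (edge (# 2) (# 1)) (edge (# 2) (# 3)) (edge (# 8) (# 1)) (edge (# 8) (# 3))
                     (distinct (# 1) (# 3)) (distinct (# 2) (# 8))

  rhombus₄ : p₆ +ᵥ p₄ ≡ p₈ +ᵥ p₉
  rhombus₄ = rhombus p₆ p₈ p₉ p₄ (edge (# 5) (# 7)) (edge (# 5) (# 8)) (edge (# 3) (# 7)) (edge (# 3) (# 8))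
                     (distinct (# 7) (# 8)) (distinct (# 5) (# 3))

  p₁-is-reflection : p₁ ≡ reflect p₅ p₇
  p₁-is-reflection = closing-parallelogramsᵥ rhombus₁ rhombus₂ rhombus₃ rhombus₄

  p₈-position : p₈ ≡ (p₆ +ᵥ p₇) -ᵥ p₅
  p₈-position = solve-forᵥ rhombus₂
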